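{- Let $m$ be a positive integer with $\omega(m)\geq 149$. Then $W(m)<m^{1/8}$.
   Context: $\omega(m)$ is the number of distinct prime divisors of $m$ and $W(m)=2^{\omega(m)}$. -}

module Defs where

open import Data.Nat using (ℕ; suc; _^_)
open import Data.Nat.Divisibility using (_∣_; _∣?_)
open import Data.Nat.Primality using (Prime; prime?)
open import Data.List using (List; length; filter; upTo)
open import Data.Product using (_×_)
open import Relation.Nullary.Decidable using (_×-dec_)

-- The prime divisors of m, listed as the primes p < m + 1 with p ∣ m.
-- (Every divisor of a positive m is ≤ m; for m = 0 this is a finite
--  truncation, irrelevant since the statement assumes m positive.)
primeDivisors : ℕ → List ℕ
primeDivisors m = filter (λ p → prime? p ×-dec (p ∣? m)) (upTo (suc m))

ω : ℕ → ℕ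
ω m = length (primeDivisors m)

W : ℕ → ℕ
W m = 2 ^ ω m

module Submission where

-- Let p₁ < p₂ < … < p_ω be the prime divisors of m.  Distinct primes
-- are pairwise coprime, so their product divides m and hence is at most m.
-- On the other hand the product of ω increasing primes is at least the
-- product of the first 149 primes times one factor 256 for each further
-- prime, because the i-th smallest of them is at least the i-th prime and
-- every prime after the 149th (= 859) exceeds 256.  A direct computation
-- shows that the product of the first 149 primes exceeds 256 ^ 149, so
--   W(m) ^ 8 = 256 ^ ω < (p₁ ⋯ p₁₄₉) · 256 ^ (ω - 149) ≤ p₁ ⋯ p_ω ≤ m.

open import Defs
open import Data.Nat using (ℕ; _≤_; _<_; _^_; zero; suc; _+_; _*_; _∸_; z≤n; s≤s; _≤?_; _<?_; NonZero; >-nonZero; >-nonZero⁻¹)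
open import Data.Nat.Properties
open import Data.Nat.Divisibility using (_∣_; _∣?_; divides; ∣-trans; 1∣_; ∣⇒≤; *-monoʳ-∣)
open import Data.Nat.Primality using (Prime; prime?; prime⇒nonZero)
open import Data.Nat.Coprimality as Coprime using (Coprime; coprime-divisor; prime⇒coprime)
open import Data.Nat.ListAction using (product)
open import Data.List using ([]; _∷_; length; upTo)
open import Data.List.Relation.Unary.All as All using (All; []; _∷_)
import Data.List.Relation.Unary.All.Properties as All
open import Data.List.Relation.Unary.AllPairs using (AllPairs; []; _∷_)
import Data.List.Relation.Unary.AllPairs.Properties as AllPairs
open import Data.Sum using (inj₁; inj₂)
open import Data.Empty using (⊥-elim)
open import Data.Product using (_×_; _,_; proj₁; proj₂)
open import Relation.Nullary using (Dec; yes; no)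
open import Relation.Nullary.Decidable using (_×-dec_; toWitness)
open import Relation.Binary.PropositionalEquality using (_≡_; refl; sym; trans; cong; subst; module ≡-Reasoning)

coprime-* : ∀ {x y z} → Coprime x y → Coprime x z → Coprime x (y * z)
coprime-* {x} {y} {z} x⊥y x⊥z {d} (d∣x , d∣yz) = x⊥z (d∣x , coprime-divisor d⊥y d∣yz)
  where
  d⊥y : Coprime d y
  d⊥y (i∣d , i∣y) = x⊥y (∣-trans i∣d d∣x , i∣y)

coprime-product : ∀ {x} xs → All (Coprime x) xs → Coprime x (product xs)
coprime-product []       []           = Coprime.sym (Coprime.1-coprimeTo _)
coprime-product (y ∷ ys) (x⊥y ∷ x⊥ys) = coprime-* x⊥y (coprime-product ys x⊥ys)

coprime-*-∣ : ∀ {a b m} → Coprime a b → a ∣ m → b ∣ m → a * b ∣ m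
coprime-*-∣ {a} {b} {m} a⊥b (divides q m≡q*a) b∣m =
  subst (a * b ∣_) m≡a*q (*-monoʳ-∣ a b∣q)
  where
  m≡a*q : a * q ≡ m
  m≡a*q = sym (trans m≡q*a (*-comm q a))
  b∣q : b ∣ q
  b∣q = coprime-divisor (Coprime.sym a⊥b) (subst (b ∣_) (sym m≡a*q) b∣m)

product-∣ : ∀ {m} xs → AllPairs Coprime xs → All (_∣ m) xs → product xs ∣ m
product-∣ []       _              _            = 1∣ _
product-∣ (x ∷ xs) (x⊥xs ∷ coprs) (x∣m ∷ xs∣m) =
  coprime-*-∣ (coprime-product xs x⊥xs) x∣m (product-∣ xs coprs xs∣m)

<-primes-coprime : ∀ {p q} → Prime p → Prime q → p < q → Coprime p q
<-primes-coprime p∈ℙ q∈ℙ p<q = Coprime.sym (prime⇒coprime q∈ℙ ⦃ prime⇒nonZero p∈ℙ ⦄ p<q)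

increasing-primes-coprime : ∀ xs → AllPairs _<_ xs → All Prime xs → AllPairs Coprime xs
increasing-primes-coprime []       _           _          = []
increasing-primes-coprime (x ∷ xs) (x<xs ∷ inc) (px ∷ pxs) =
  All.zipWith coprimeToLarger (x<xs , pxs) ∷ increasing-primes-coprime xs inc pxs
  where
  coprimeToLarger : ∀ {y} → x < y × Prime y → Coprime x y
  coprimeToLarger (x<y , y∈ℙ) = <-primes-coprime px y∈ℙ x<y

isPrimeDivisorOf? : ∀ m p → Dec (Prime p × p ∣ m)
isPrimeDivisorOf? m p = prime? p ×-dec (p ∣? m)

primeDivisors-increasing : ∀ m → AllPairs _<_ (primeDivisors m)
primeDivisors-increasing m =
  AllPairs.filter⁺ (isPrimeDivisorOf? m) (AllPairs.applyUpTo⁺₁ (λ i → i) (suc m) (λ i<j _ → i<j))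

primeDivisors-sound : ∀ m → All (λ p → Prime p × p ∣ m) (primeDivisors m)
primeDivisors-sound m = All.all-filter (isPrimeDivisorOf? m) (upTo (suc m))

product-primeDivisors-≤ : ∀ m → 0 < m → product (primeDivisors m) ≤ m
product-primeDivisors-≤ m 0<m = ∣⇒≤ ⦃ >-nonZero 0<m ⦄
  (product-∣ ps (increasing-primes-coprime ps (primeDivisors-increasing m) (All.map proj₁ sound))
                (All.map proj₂ sound))
  where
  ps = primeDivisors m
  sound = primeDivisors-sound m

-- primeProductBound b fuel a k is the product of the k smallest primes
-- above a, searched among at most fuel candidates, provided every prime
-- after the last of them is ≥ b; otherwise it is the trivial bound 0.
primeProductBound : (b fuel a k : ℕ) → ℕ
primeProductBound b zero       a k       = 0
primeProductBound b (suc fuel) a zero    with b ≤? suc a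
... | yes _ = 1
... | no  _ = 0
primeProductBound b (suc fuel) a (suc k) with prime? (suc a)
... | yes _ = suc a * primeProductBound b fuel (suc a) k
... | no  _ = primeProductBound b fuel (suc a) (suc k)

power-≤-product : ∀ {b} xs → All (b ≤_) xs → b ^ length xs ≤ product xs
power-≤-product []       []           = ≤-refl
power-≤-product (x ∷ xs) (b≤x ∷ b≤xs) = *-mono-≤ b≤x (power-≤-product xs b≤xs)

-- The product of n ≥ k increasing primes above a is at least
-- primeProductBound b fuel a k times b for each of the remaining n - k primes:
-- the i-th of them is at least the i-th prime above a.
increasing-primes-product : ∀ b fuel a k xs → AllPairs _<_ xs → All Prime xs → All (a <_) xs →
  k ≤ length xs → primeProductBound b fuel a k * b ^ (length xs ∸ k) ≤ product xs
increasing-primes-product b zero a k xs _ _ _ _ = z≤n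
increasing-primes-product b (suc fuel) a zero xs _ _ a<xs _ with b ≤? suc a
... | yes b≤1+a = subst (_≤ product xs) (sym (+-identityʳ _))
                    (power-≤-product xs (All.map (≤-trans b≤1+a) a<xs))
... | no  _     = z≤n
increasing-primes-product b (suc fuel) a (suc k) (x ∷ xs) (x<xs ∷ inc) (px ∷ pxs) (a<x ∷ a<xs) (s≤s k≤n)
  with prime? (suc a)
... | yes _ = subst (_≤ x * product xs)
                (sym (*-assoc (suc a) (primeProductBound b fuel (suc a) k) (b ^ (length xs ∸ k))))
                (*-mono-≤ a<x (increasing-primes-product b fuel (suc a) k xs inc pxs
                                 (All.map (≤-<-trans a<x) x<xs) k≤n))
... | no 1+a∉ℙ = increasing-primes-product b fuel (suc a) (suc k) (x ∷ xs) (x<xs ∷ inc) (px ∷ pxs)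
                   (1+a<x ∷ All.map (<-trans 1+a<x) x<xs) (s≤s k≤n)
  where
  -- a < x and x is prime while a + 1 is not, so a + 1 < x.
  1+a<x : suc a < x
  1+a<x with m≤n⇒m<n∨m≡n a<x
  ... | inj₁ 1+a<x = 1+a<x
  ... | inj₂ refl  = ⊥-elim (1+a∉ℙ px)

power-<-bound*power : ∀ b n k g → .{{NonZero b}} → n ≤ k → b ^ n < g → b ^ k < g * b ^ (k ∸ n)
power-<-bound*power b n k g n≤k bⁿ<g = begin-strict
  b ^ k                  ≡⟨ cong (b ^_) (m+[n∸m]≡n n≤k) ⟨
  b ^ (n + (k ∸ n))      ≡⟨ ^-distribˡ-+-* b n (k ∸ n) ⟩
  b ^ n * b ^ (k ∸ n)    <⟨ *-monoˡ-< (b ^ (k ∸ n)) ⦃ m^n≢0 b (k ∸ n) ⦄ bⁿ<g ⟩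
  g * b ^ (k ∸ n)        ∎
  where open ≤-Reasoning

-- The product of the first 149 primes (the last being 859 > 256), and the
-- fact, checked by evaluation, that it exceeds 256 ^ 149.  The block is
-- abstract so that the large number is not unfolded when it is used.
abstract
  first149PrimesBound : ℕ
  first149PrimesBound = primeProductBound 256 1000 0 149

  first149PrimesBound-large : 256 ^ 149 < first149PrimesBound
  first149PrimesBound-large = toWitness {a? = 256 ^ 149 <? first149PrimesBound} _

  first149PrimesBound-≤ : ∀ xs → AllPairs _<_ xs → All Prime xs → 149 ≤ length xs →
    first149PrimesBound * 256 ^ (length xs ∸ 149) ≤ product xs
  first149PrimesBound-≤ xs inc xs∈ℙ 149≤n =
    increasing-primes-product 256 1000 0 149 xs inc xs∈ℙ (All.map prime>0 xs∈ℙ) 149≤n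
    where
    prime>0 : ∀ {p} → Prime p → 0 < p
    prime>0 p∈ℙ = >-nonZero⁻¹ _ ⦃ prime⇒nonZero p∈ℙ ⦄

W^8≡256^ω : ∀ m → W m ^ 8 ≡ 256 ^ ω m
W^8≡256^ω m = begin
  (2 ^ ω m) ^ 8   ≡⟨ ^-*-assoc 2 (ω m) 8 ⟩
  2 ^ (ω m * 8)   ≡⟨ cong (2 ^_) (*-comm (ω m) 8) ⟩
  2 ^ (8 * ω m)   ≡⟨ ^-*-assoc 2 8 (ω m) ⟨
  256 ^ ω m       ∎
  where open ≡-Reasoning

lemma5p1 : (m : ℕ) → 0 < m → 149 ≤ ω m → W m ^ 8 < m
lemma5p1 m 0<m 149≤ω = begin-strict
  W m ^ 8                                         ≡⟨ W^8≡256^ω m ⟩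
  256 ^ ω m                                       <⟨ power-<-bound*power 256 149 (ω m) _ 149≤ω
                                                       first149PrimesBound-large ⟩
  first149PrimesBound * 256 ^ (ω m ∸ 149)         ≤⟨ first149PrimesBound-≤ ps (primeDivisors-increasing m)
                                                       (All.map proj₁ (primeDivisors-sound m)) 149≤ω ⟩
  product ps                                      ≤⟨ product-primeDivisors-≤ m 0<m ⟩
  m                                               ∎
  where
  open ≤-Reasoning
  ps = primeDivisors m
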